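{- Let $p$ be a prime, $\psi : \mathbb{N} \to \mathbb{R}_{>0}$, and $n = m \in \mathbb{N}$ with $p \nmid n$. Then the number of pairs $(a,b)$ with $a, b \in \{1, \dots, n\}$, $a \ne b$, such that \[ \left|\frac{a}{n} - \frac{b}{m}\right|_p < \max\{\psi^*(n), \psi^*(m)\} \] is at most $4nm\max\{\psi^*(n), \psi^*(m)\}$.
   Context: $|\cdot|_p$ is the $p$-adic absolute value. For $t>0$, $t^*$ denotes the unique integer power of $p$ with $\frac{t}{p} < t^* \le t$; $\psi^*(n) := (\psi(n))^*$.
   Formalization: The function $\psi$ takes positive rational values instead of values in $\mathbb{R}_{>0}$. -}

module Defs where

open import Data.Nat as ℕ using (ℕ; zero; suc; _^_)
open import Data.Nat.Properties using (m^n≢0)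
open import Data.Nat.Divisibility using (_∣?_)
open import Data.Nat.DivMod using (_/_)
open import Data.Integer as ℤ using (ℤ; +_; -[1+_])
open import Data.Rational as ℚ using (ℚ; _<_; _≤_; _*_; _-_; _⊔_; _<?_)
open import Data.Rational.Properties using ()
open import Data.List using (List; upTo; map; concatMap; filter; length)
open import Data.Product using (_×_; _,_; ∃-syntax)
open import Relation.Binary.PropositionalEquality using (_≡_; _≢_)
open import Relation.Nullary using (Dec; yes; no; ¬?)
open import Relation.Nullary.Decidable using (_×-dec_)
open import Data.Nat.Properties using (_≟_)

-- p-adic valuation of a natural number n (with fuel f); for p ≥ 2 and
-- n ≠ 0, fuel n suffices: v_p(n) = largest k with p^k ∣ n.
vpFuel : ℕ → ℕ → ℕ → ℕ
vpFuel zero _ _ = 0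
vpFuel (suc f) (suc (suc q)) (suc k) with suc (suc q) ∣? suc k
... | yes _ = suc (vpFuel f (suc (suc q)) (suc k / suc (suc q)))
... | no _ = 0
vpFuel (suc f) _ _ = 0

vp : ℕ → ℕ → ℕ
vp p n = vpFuel n p n

-- p^k as a rational, for k ∈ ℤ (junk value 0 when p = 0)
pPow : ℕ → ℤ → ℚ
pPow p (+ k) = (+ (p ^ k)) ℚ./ 1
pPow zero -[1+ k ] = ℚ.0ℚ
pPow (suc q) -[1+ k ] = ℚ._/_ (+ 1) (suc q ^ suc k) {{m^n≢0 (suc q) (suc k)}}

padicAbs : ℕ → ℚ → ℚ
padicAbs p x with ℚ.numerator x
... | + zero = ℚ.0ℚ
... | num = pPow p (+ vp p (ℚ.denominatorℕ x) ℤ.- + vp p (ℤ.∣ num ∣))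

-- the rational a / n (junk value 0 when n = 0)
frac : ℕ → ℕ → ℚ
frac a zero = ℚ.0ℚ
frac a (suc k) = (+ a) ℚ./ suc k

-- IsStar p t s : s = t*, i.e. s is an integer power of p with t/p < s ≤ t
-- (t/p < s is written as t < p·s)
IsStar : ℕ → ℚ → ℚ → Set
IsStar p t s = (∃[ k ] s ≡ pPow p k) × (t < (+ p ℚ./ 1) * s) × (s ≤ t)

pairs : ℕ → ℕ → List (ℕ × ℕ)
pairs n m = concatMap (λ a → map (λ b → (a , b)) (map suc (upTo m))) (map suc (upTo n))

countClose : ℕ → ℕ → ℕ → ℚ → ℕ
countClose p n m r = length (filter
  (λ ab → ¬? (Data.Product.proj₁ ab ≟ Data.Product.proj₂ ab)
          ×-dec (padicAbs p (frac (Data.Product.proj₁ ab) n ℚ.- frac (Data.Product.proj₂ ab) m) <? r))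
  (pairs n m))

{-# OPTIONS --safe #-}
-- Write s = max(ψ*(n), ψ*(m)) = p^k. The reduced numerator of a/n − b/n = (a − b)/n
-- divides a − b, so for k = −(i+1) the condition |a/n − b/n|_p < p^k forces
-- q := p^(i+1) ∣ a − b; for k ≥ 0 only a ≠ b is used and q := 1. In a fixed row a,
-- the b ∈ {1, …, n} with b ≠ a and q ∣ a − b are pairwise at least q apart, so there
-- are fewer than (n + q)/q of them, and none when q > n. Summing over the n rows
-- gives count · q ≤ 2n² ≤ 4n² · p^k · q.
module Submission where

module SeparatedCounting where

  open import Level using (Level)
  open import Function using (_∘_)
  open import Data.Nat.Base
  open import Data.Nat.Properties
  open import Data.List.Base using (List; []; _∷_; _++_; filter; length; concatMap; applyUpTo)
  open import Data.List.Properties using (filter-++; length-++)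
  open import Data.List.Relation.Unary.All using (All; []; _∷_)
  open import Data.List.Relation.Binary.Sublist.Propositional using (⊆-refl)
  open import Data.List.Relation.Binary.Sublist.Propositional.Properties using (filter⁺; length-mono-≤)
  open import Relation.Binary.PropositionalEquality
  open import Relation.Nullary using (yes; no; ¬_; contradiction)
  open import Relation.Unary using (Pred; Decidable; _⊆_)

  private
    variable
      a b ℓ ℓ′ : Level
      A : Set a
      B : Set b

  Separated : ℕ → Pred ℕ ℓ → Set ℓ
  Separated q R = ∀ {i j} → R i → R (i + j) → 0 < j → q ≤ j

  separated-suc : ∀ {q} {R : Pred ℕ ℓ} → Separated q R → Separated q (R ∘ suc)
  separated-suc sep {i} {j} = sep {suc i} {j}

  module _ {P : Pred A ℓ} (P? : Decidable P) where

    length-filter-applyUpTo-separated : ∀ {q} .{{_ : NonZero q}} (f : ℕ → A) len →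
      Separated q (P ∘ f) → length (filter P? (applyUpTo f len)) * q < len + q
    length-filter-applyUpTo-separated {suc q} f len sep = go f len 0 sep z<s (λ ())
      where
      go : ∀ f len r → Separated (suc q) (P ∘ f) → r < suc q → (∀ {i} → i < r → ¬ P (f i)) →
           r + length (filter P? (applyUpTo f len)) * suc q < len + suc q
      go f zero r _ r<q _ = subst (_< suc q) (sym (+-identityʳ r)) r<q
      go f (suc len) r sep r<q free with P? (f 0) | r
      ... | yes hit | zero = s≤s (go (f ∘ suc) len q (separated-suc {R = P ∘ f} sep) ≤-refl
                               (λ {i} i<q hit′ → <⇒≱ (s≤s i<q) (sep {0} {suc i} hit hit′ z<s)))
      ... | yes hit | suc _ = contradiction hit (free z<s)
      ... | no _ | zero = m<n⇒m<1+n (go (f ∘ suc) len 0 (separated-suc {R = P ∘ f} sep) z<s (λ ()))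
      ... | no _ | suc r =
        s≤s (go (f ∘ suc) len r (separated-suc {R = P ∘ f} sep) (<⇒≤ r<q) (free ∘ s≤s))

    length-filter-concatMap-≤ : ∀ (f : B → List A) {k m xs} →
      All (λ x → length (filter P? (f x)) * k ≤ m) xs →
      length (filter P? (concatMap f xs)) * k ≤ length xs * m
    length-filter-concatMap-≤ f [] = z≤n
    length-filter-concatMap-≤ f {k} {m} {x ∷ xs} (bound ∷ bounds) = begin
      length (filter P? (f x ++ concatMap f xs)) * k
        ≡⟨ cong (λ ys → length ys * k) (filter-++ P? (f x) (concatMap f xs)) ⟩
      length (filter P? (f x) ++ filter P? (concatMap f xs)) * k
        ≡⟨ cong (_* k) (length-++ (filter P? (f x))) ⟩
      (length (filter P? (f x)) + length (filter P? (concatMap f xs))) * k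
        ≡⟨ *-distribʳ-+ k (length (filter P? (f x))) _ ⟩
      length (filter P? (f x)) * k + length (filter P? (concatMap f xs)) * k
        ≤⟨ +-mono-≤ bound (length-filter-concatMap-≤ f bounds) ⟩
      m + length xs * m ∎
      where open ≤-Reasoning

  module _ {P : Pred A ℓ} {Q : Pred A ℓ′} (P? : Decidable P) (Q? : Decidable Q) where

    length-filter-mono : P ⊆ Q → ∀ xs → length (filter P? xs) ≤ length (filter Q? xs)
    length-filter-mono P⊆Q xs = length-mono-≤ (filter⁺ P? Q? (λ { refl → P⊆Q }) (⊆-refl {x = xs}))

module CongruentPairs where

  open SeparatedCounting
  open import Defs using (pairs)
  open import Level using (0ℓ)
  open import Function using (_∘_; id)
  open import Data.Nat.Base
  open import Data.Nat.Properties
  open import Data.Nat.Divisibility using (_∣_; _∣?_; ∣⇒≤)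
  open import Data.Integer.Base as ℤ using (+_)
  import Data.Integer.Properties as ℤ
  import Data.Integer.Divisibility.Signed as ℤ
  open import Data.Integer.Tactic.RingSolver using (solve-∀)
  open import Data.List.Base using (List; []; map; filter; length; concatMap; applyUpTo; upTo)
  open import Data.List.Properties
    using (filter-none; length-map; length-upTo; map-upTo; map-applyUpTo; concatMap-cong)
  import Data.List.Relation.Unary.All.Properties as All
  open import Data.Product using (_×_; _,_)
  open import Relation.Binary.PropositionalEquality
  open import Relation.Nullary using (yes; no; ¬?)
  open import Relation.Nullary.Decidable using (_×-dec_)
  open import Relation.Unary using (Pred; Decidable)

  CongruentPair : ℕ → Pred (ℕ × ℕ) 0ℓ
  CongruentPair q (a , b) = a ≢ b × q ∣ ℤ.∣ + a ℤ.- + b ∣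

  congruentPair? : ∀ q → Decidable (CongruentPair q)
  congruentPair? q (a , b) = ¬? (a ≟ b) ×-dec (q ∣? ℤ.∣ + a ℤ.- + b ∣)

  [c-m]-[c-[m+j]]≡j : ∀ c m j → (c ℤ.- m) ℤ.- (c ℤ.- (m ℤ.+ j)) ≡ j
  [c-m]-[c-[m+j]]≡j = solve-∀

  ∣c-m∣c-[m+j]⇒∣j : ∀ {q} c m j → q ∣ ℤ.∣ c ℤ.- + m ∣ → q ∣ ℤ.∣ c ℤ.- + (m + j) ∣ → q ∣ j
  ∣c-m∣c-[m+j]⇒∣j {q} c m j q∣c-m q∣c-m-j = ℤ.∣⇒∣ᵤ (subst (+ q ℤ.∣_) difference
    (ℤ.∣m∣n⇒∣m-n (ℤ.∣ᵤ⇒∣ {i = c ℤ.- + m} q∣c-m) (ℤ.∣ᵤ⇒∣ {i = c ℤ.- + (m + j)} q∣c-m-j)))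
    where
    difference : (c ℤ.- + m) ℤ.- (c ℤ.- + (m + j)) ≡ + j
    difference rewrite ℤ.pos-+ m j = [c-m]-[c-[m+j]]≡j c (+ m) (+ j)

  congruent⇒≤⊔ : ∀ {q a b} → CongruentPair q (a , b) → q ≤ a ⊔ b
  congruent⇒≤⊔ {q} {a} {b} (a≢b , q∣a-b) = begin
    q                   ≤⟨ ∣⇒≤ {{≢-nonZero ∣a-b∣≢0}} q∣a-b ⟩
    ℤ.∣ + a ℤ.- + b ∣   ≡⟨ cong ℤ.∣_∣ (ℤ.[+m]-[+n]≡m⊖n a b) ⟩
    ℤ.∣ a ℤ.⊖ b ∣       ≤⟨ ℤ.∣m⊝n∣≤m⊔n a b ⟩
    a ⊔ b               ∎
    where
    open ≤-Reasoning
    ∣a-b∣≢0 : ℤ.∣ + a ℤ.- + b ∣ ≢ 0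
    ∣a-b∣≢0 = a≢b ∘ ℤ.+-injective ∘ ℤ.i-j≡0⇒i≡j (+ a) (+ b) ∘ ℤ.∣i∣≡0⇒i≡0

  row : ℕ → ℕ → List (ℕ × ℕ)
  row n a = applyUpTo (λ i → a , suc i) n

  pairs≡concatMap-row : ∀ n → pairs n n ≡ concatMap (row n) (map suc (upTo n))
  pairs≡concatMap-row n = concatMap-cong
    (λ a → trans (cong (map (a ,_)) (map-upTo suc n)) (map-applyUpTo suc (a ,_) n))
    (map suc (upTo n))

  congruent-row-bound : ∀ q .{{_ : NonZero q}} {n a} → a ≤ n →
    length (filter (congruentPair? q) (row n a)) * q ≤ n + n
  congruent-row-bound q {n} {a} a≤n with q ≤? n
  ... | yes q≤n = <⇒≤ (<-≤-trans
          (length-filter-applyUpTo-separated (congruentPair? q) (λ i → a , suc i) n separated)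
          (+-monoʳ-≤ n q≤n))
    where
    separated : Separated q (CongruentPair q ∘ (λ i → a , suc i))
    separated {i} {j} (_ , q∣a-b) (_ , q∣a-b-j) j>0 =
      ∣⇒≤ {{>-nonZero j>0}} (∣c-m∣c-[m+j]⇒∣j (+ a) (suc i) j q∣a-b q∣a-b-j)
  ... | no q≰n = ≤-trans (≤-reflexive (cong (λ xs → length xs * q) no-hits)) z≤n
    where
    no-hits : filter (congruentPair? q) (row n a) ≡ []
    no-hits = filter-none (congruentPair? q) (All.applyUpTo⁺₁ (λ i → a , suc i) n
                (λ i<n c → q≰n (≤-trans (congruent⇒≤⊔ c) (⊔-lub a≤n i<n))))

  congruent-pairs-bound : ∀ q .{{_ : NonZero q}} n →
    length (filter (congruentPair? q) (pairs n n)) * q ≤ n * (n + n)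
  congruent-pairs-bound q n = begin
    length (filter (congruentPair? q) (pairs n n)) * q
      ≡⟨ cong (λ xs → length (filter (congruentPair? q) xs) * q) (pairs≡concatMap-row n) ⟩
    length (filter (congruentPair? q) (concatMap (row n) (map suc (upTo n)))) * q
      ≤⟨ length-filter-concatMap-≤ (congruentPair? q) (row n)
           (All.map⁺ (All.applyUpTo⁺₁ id n (congruent-row-bound q))) ⟩
    length (map suc (upTo n)) * (n + n)
      ≡⟨ cong (_* (n + n)) (trans (length-map suc (upTo n)) (length-upTo n)) ⟩
    n * (n + n) ∎
    where open ≤-Reasoning

-- For a denominator suc d, i / suc d is definitionally fromℚᵘ (mkℚᵘ i d), so
-- toℚᵘ-fromℚᵘ yields its unnormalised form; all identities below are checked there.
module Fractions where

  open import Data.Nat.Base as ℕ using (suc; NonZero)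
  import Data.Nat.Properties as ℕ
  open import Data.Integer.Base as ℤ using (+_; +≤+)
  import Data.Integer.Properties as ℤ
  import Data.Integer.Divisibility.Signed as ℤ
  open import Data.Integer.GCD using (gcd)
  open import Data.Integer.Tactic.RingSolver using (solve-∀)
  open import Data.Rational.Base as ℚ using (_/_; _≤_; _*_; _-_; ↥_; toℚᵘ)
  open import Data.Rational.Properties
    using (toℚᵘ-fromℚᵘ; toℚᵘ-cancel-≤; toℚᵘ-injective; toℚᵘ-homo-*; toℚᵘ-homo-+; toℚᵘ-homo‿-; ↥-/)
  open import Data.Rational.Unnormalised.Base as ℚᵘ using (mkℚᵘ; *≤*; *≡*)
  import Data.Rational.Unnormalised.Properties as ℚᵘ
  open import Relation.Binary.PropositionalEquality

  +a/b≤+c/d : ∀ a b c d .{{_ : NonZero b}} .{{_ : NonZero d}} →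
    a ℕ.* d ℕ.≤ c ℕ.* b → + a / b ≤ + c / d
  +a/b≤+c/d a (suc b) c (suc d) ad≤cb = toℚᵘ-cancel-≤
    (ℚᵘ.≤-respˡ-≃ (ℚᵘ.≃-sym (toℚᵘ-fromℚᵘ (mkℚᵘ (+ a) b)))
    (ℚᵘ.≤-respʳ-≃ (ℚᵘ.≃-sym (toℚᵘ-fromℚᵘ (mkℚᵘ (+ c) d)))
    (*≤* (subst₂ ℤ._≤_ (ℤ.pos-* a (suc d)) (ℤ.pos-* c (suc b)) (+≤+ ad≤cb)))))

  +m/1*+a/d≡+[m*a]/d : ∀ m a d .{{_ : NonZero d}} → (+ m / 1) * (+ a / d) ≡ + (m ℕ.* a) / d
  +m/1*+a/d≡+[m*a]/d m a (suc d) = toℚᵘ-injective (begin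
    toℚᵘ ((+ m / 1) * (+ a / suc d))
      ≈⟨ toℚᵘ-homo-* (+ m / 1) (+ a / suc d) ⟩
    toℚᵘ (+ m / 1) ℚᵘ.* toℚᵘ (+ a / suc d)
      ≈⟨ ℚᵘ.*-cong (toℚᵘ-fromℚᵘ (mkℚᵘ (+ m) 0)) (toℚᵘ-fromℚᵘ (mkℚᵘ (+ a) d)) ⟩
    mkℚᵘ (+ m) 0 ℚᵘ.* mkℚᵘ (+ a) d
      ≈⟨ *≡* (cong₂ ℤ._*_ (sym (ℤ.pos-* m a)) (cong (λ e → + suc e) (sym (ℕ.+-identityʳ d)))) ⟩
    mkℚᵘ (+ (m ℕ.* a)) d
      ≈⟨ ℚᵘ.≃-sym (toℚᵘ-fromℚᵘ (mkℚᵘ (+ (m ℕ.* a)) d)) ⟩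
    toℚᵘ (+ (m ℕ.* a) / suc d) ∎)
    where open ℚᵘ.≃-Reasoning

  [i*d-j*d]*d≡[i-j]*[d*d] : ∀ i j d → (i ℤ.* d ℤ.+ ℤ.- j ℤ.* d) ℤ.* d ≡ (i ℤ.- j) ℤ.* (d ℤ.* d)
  [i*d-j*d]*d≡[i-j]*[d*d] = solve-∀

  i/n-j/n≡[i-j]/n : ∀ i j n .{{_ : NonZero n}} → i / n - j / n ≡ (i ℤ.- j) / n
  i/n-j/n≡[i-j]/n i j (suc d) = toℚᵘ-injective (begin
    toℚᵘ (i / suc d - j / suc d)
      ≈⟨ toℚᵘ-homo-+ (i / suc d) (ℚ.- (j / suc d)) ⟩
    toℚᵘ (i / suc d) ℚᵘ.+ toℚᵘ (ℚ.- (j / suc d))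
      ≈⟨ ℚᵘ.+-cong (toℚᵘ-fromℚᵘ (mkℚᵘ i d))
                   (ℚᵘ.≃-trans (toℚᵘ-homo‿- (j / suc d)) (ℚᵘ.-‿cong (toℚᵘ-fromℚᵘ (mkℚᵘ j d)))) ⟩
    mkℚᵘ i d ℚᵘ.- mkℚᵘ j d
      ≈⟨ *≡* (trans ([i*d-j*d]*d≡[i-j]*[d*d] i j (+ suc d))
                    (cong ((i ℤ.- j) ℤ.*_) (sym (ℤ.pos-* (suc d) (suc d))))) ⟩
    mkℚᵘ (i ℤ.- j) d
      ≈⟨ ℚᵘ.≃-sym (toℚᵘ-fromℚᵘ (mkℚᵘ (i ℤ.- j) d)) ⟩
    toℚᵘ ((i ℤ.- j) / suc d) ∎)
    where open ℚᵘ.≃-Reasoning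

  ↥[i/n]∣i : ∀ i n .{{_ : NonZero n}} → ↥ (i / n) ℤ.∣ i
  ↥[i/n]∣i i n =
    ℤ.divides (gcd i (+ n)) (sym (trans (ℤ.*-comm (gcd i (+ n)) (↥ (i / n))) (↥-/ i n)))

module PAdic where

  open Fractions
  open import Defs using (vpFuel; vp; pPow; padicAbs)
  open import Data.Nat.Base as ℕ using (zero; suc; NonZero; _^_; z≤n; s≤s)
  import Data.Nat.Properties as ℕ
  open import Data.Nat.Divisibility using (_∣_; _∣?_; 1∣_; _∣0; ∣-trans; *-monoʳ-∣; m∣m*n)
  open import Data.Nat.DivMod using (_/_; m*[n/m]≡n)
  open import Data.Integer.Base as ℤ using (+_; -[1+_]; +≤+; -≤+; -≤-)
  import Data.Integer.Properties as ℤ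
  open import Data.Rational.Base as ℚ using (mkℚ; ↥_)
  import Data.Rational.Properties as ℚ
  open import Relation.Binary.PropositionalEquality
  open import Relation.Nullary using (yes; no; contradiction)

  ^vpFuel∣ : ∀ f p N → p ^ vpFuel f p N ∣ N
  ^vpFuel∣ zero p N = 1∣ N
  ^vpFuel∣ (suc f) zero N = 1∣ N
  ^vpFuel∣ (suc f) (suc zero) N = 1∣ N
  ^vpFuel∣ (suc f) (suc (suc q)) zero = 1∣ 0
  ^vpFuel∣ (suc f) p@(suc (suc q)) (suc k) with p ∣? suc k
  ... | yes p∣N = subst (p ℕ.* p ^ vpFuel f p (suc k / p) ∣_) (m*[n/m]≡n p∣N)
                    (*-monoʳ-∣ p (^vpFuel∣ f p (suc k / p)))
  ... | no _ = 1∣ suc k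

  ^vp∣ : ∀ p N → p ^ vp p N ∣ N
  ^vp∣ p N = ^vpFuel∣ N p N

  ^-monoʳ-∣ : ∀ p {m n} → m ℕ.≤ n → p ^ m ∣ p ^ n
  ^-monoʳ-∣ p {m} {n} m≤n = subst (λ e → p ^ m ∣ p ^ e) (ℕ.m+[n∸m]≡n m≤n)
    (subst (p ^ m ∣_) (sym (ℕ.^-distribˡ-+-* p m (n ℕ.∸ m))) (m∣m*n (p ^ (n ℕ.∸ m))))

  pPow-mono-≤ : ∀ p .{{_ : NonZero p}} {k l} → k ℤ.≤ l → pPow p k ℚ.≤ pPow p l
  pPow-mono-≤ p@(suc _) { -[1+ m ]} { -[1+ n ]} (-≤- n≤m) =
    +a/b≤+c/d 1 (p ^ suc m) 1 (p ^ suc n) {{ℕ.m^n≢0 p (suc m)}} {{ℕ.m^n≢0 p (suc n)}}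
      (ℕ.*-monoʳ-≤ 1 (ℕ.^-monoʳ-≤ p (s≤s n≤m)))
  pPow-mono-≤ p@(suc _) { -[1+ m ]} {+ n} -≤+ =
    +a/b≤+c/d 1 (p ^ suc m) (p ^ n) 1 {{ℕ.m^n≢0 p (suc m)}}
      (ℕ.*-mono-≤ (ℕ.m^n>0 p n) (ℕ.m^n>0 p (suc m)))
  pPow-mono-≤ p@(suc _) {+ m} {+ n} (+≤+ m≤n) =
    +a/b≤+c/d (p ^ m) 1 (p ^ n) 1 (ℕ.*-monoˡ-≤ 1 (ℕ.^-monoʳ-≤ p m≤n))

  pPow-cancel-< : ∀ p .{{_ : NonZero p}} {k l} → pPow p k ℚ.< pPow p l → k ℤ.< l
  pPow-cancel-< p {k} {l} pᵏ<pˡ with k ℤ.<? l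
  ... | yes k<l = k<l
  ... | no k≮l = contradiction (ℚ.<-≤-trans pᵏ<pˡ (pPow-mono-≤ p (ℤ.≮⇒≥ k≮l))) (ℚ.<-irrefl refl)

  +m-+n<-[1+i]⇒i<n : ∀ m n i → + m ℤ.- + n ℤ.< -[1+ i ] → i ℕ.< n
  +m-+n<-[1+i]⇒i<n m n i m-n<-1-i with suc i ℕ.≤? n
  ... | yes i<n = i<n
  ... | no i≮n = contradiction m-n<-1-i (ℤ.≤⇒≯ (begin
    -[1+ i ]            ≤⟨ ℤ.neg-mono-≤ (+≤+ (ℕ.m≤n⇒m≤1+n (ℕ.≮⇒≥ i≮n))) ⟩
    ℤ.- + n             ≡⟨ ℤ.+-identityˡ (ℤ.- + n) ⟨
    + 0 ℤ.+ ℤ.- + n     ≤⟨ ℤ.+-monoˡ-≤ (ℤ.- + n) (+≤+ z≤n) ⟩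
    + m ℤ.- + n         ∎))
    where open ℤ.≤-Reasoning

  pPow[m-vp[N]]<p⁻ⁱ⁻¹⇒pⁱ⁺¹∣N : ∀ p .{{_ : NonZero p}} i m N →
    pPow p (+ m ℤ.- + vp p N) ℚ.< pPow p -[1+ i ] → p ^ suc i ∣ N
  pPow[m-vp[N]]<p⁻ⁱ⁻¹⇒pⁱ⁺¹∣N p i m N small =
    ∣-trans (^-monoʳ-∣ p (+m-+n<-[1+i]⇒i<n m (vp p N) i (pPow-cancel-< p small))) (^vp∣ p N)

  padicAbs<p⁻ⁱ⁻¹⇒pⁱ⁺¹∣↥ : ∀ p .{{_ : NonZero p}} i x →
    padicAbs p x ℚ.< pPow p -[1+ i ] → p ^ suc i ∣ ℤ.∣ ↥ x ∣
  padicAbs<p⁻ⁱ⁻¹⇒pⁱ⁺¹∣↥ p i (mkℚ (+ zero)  _ _) _ = _ ∣0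
  padicAbs<p⁻ⁱ⁻¹⇒pⁱ⁺¹∣↥ p i (mkℚ (+ suc t) d _) small =
    pPow[m-vp[N]]<p⁻ⁱ⁻¹⇒pⁱ⁺¹∣N p i (vp p (suc d)) (suc t) small
  padicAbs<p⁻ⁱ⁻¹⇒pⁱ⁺¹∣↥ p i (mkℚ -[1+ t ]  d _) small =
    pPow[m-vp[N]]<p⁻ⁱ⁻¹⇒pⁱ⁺¹∣N p i (vp p (suc d)) (suc t) small

open SeparatedCounting
open CongruentPairs
open Fractions
open PAdic
open import Defs
open import Level using (0ℓ)
open import Data.Nat.Base as ℕ using (ℕ; zero; suc; NonZero; _^_; z≤n)
import Data.Nat.Properties as ℕ
open import Data.Nat.Tactic.RingSolver using (solve-∀)
open import Data.Nat.Divisibility using (_∣_; 1∣_; ∣-trans)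
open import Data.Nat.Primality using (Prime; prime)
open import Data.Integer.Base as ℤ using (+_; -[1+_])
import Data.Integer.Divisibility.Signed as ℤ
open import Data.Rational.Base as ℚ using (ℚ; 0ℚ; _<_; _≤_; _*_; _⊔_; _/_)
import Data.Rational.Properties as ℚ
open import Data.Product using (_×_; _,_; proj₁; proj₂; ∃-syntax)
open import Data.Sum using (inj₁; inj₂)
open import Relation.Binary.PropositionalEquality
open import Relation.Nullary using (¬_; ¬?)
open import Relation.Nullary.Decidable using (_×-dec_)
open import Relation.Unary using (Pred; Decidable; _⊆_)

-- Stated with projections so that filter (close? p n r) is definitionally the
-- filter inside countClose.
Close : ℕ → ℕ → ℚ → Pred (ℕ × ℕ) 0ℓ
Close p n r ab = proj₁ ab ≢ proj₂ ab × padicAbs p (frac (proj₁ ab) n ℚ.- frac (proj₂ ab) n) < r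

close? : ∀ p n r → Decidable (Close p n r)
close? p n r ab =
  ¬? (proj₁ ab ℕ.≟ proj₂ ab) ×-dec (padicAbs p (frac (proj₁ ab) n ℚ.- frac (proj₂ ab) n) ℚ.<? r)

↥[a/n-b/n]∣a-b : ∀ a b n .{{_ : NonZero n}} →
  ℤ.∣ ℚ.↥ (frac a n ℚ.- frac b n) ∣ ∣ ℤ.∣ + a ℤ.- + b ∣
↥[a/n-b/n]∣a-b a b n@(suc _) = ℤ.∣⇒∣ᵤ (subst (λ x → ℚ.↥ x ℤ.∣ (+ a ℤ.- + b))
  (sym (i/n-j/n≡[i-j]/n (+ a) (+ b) n)) (↥[i/n]∣i (+ a ℤ.- + b) n))

close⇒congruent : ∀ p .{{_ : NonZero p}} n .{{_ : NonZero n}} i →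
  Close p n (pPow p -[1+ i ]) ⊆ CongruentPair (p ^ suc i)
close⇒congruent p n i {a , b} (a≢b , small) =
  a≢b , ∣-trans (padicAbs<p⁻ⁱ⁻¹⇒pⁱ⁺¹∣↥ p i (frac a n ℚ.- frac b n) small) (↥[a/n-b/n]∣a-b a b n)

countClose*q≤n*[n+n] : ∀ p n r q .{{_ : NonZero q}} → Close p n r ⊆ CongruentPair q →
  countClose p n n r ℕ.* q ℕ.≤ n ℕ.* (n ℕ.+ n)
countClose*q≤n*[n+n] p n r q close⇒cong = ℕ.≤-trans
  (ℕ.*-monoˡ-≤ q (length-filter-mono (close? p n r) (congruentPair? q) close⇒cong (pairs n n)))
  (congruent-pairs-bound q n)

n*[n+n]+n*[n+n]≡4*[n*n] : ∀ n → n ℕ.* (n ℕ.+ n) ℕ.+ n ℕ.* (n ℕ.+ n) ≡ 4 ℕ.* (n ℕ.* n)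
n*[n+n]+n*[n+n]≡4*[n*n] = solve-∀

n*[n+n]≤4*[n*[n*N]] : ∀ n N .{{_ : NonZero N}} → n ℕ.* (n ℕ.+ n) ℕ.≤ 4 ℕ.* (n ℕ.* (n ℕ.* N))
n*[n+n]≤4*[n*[n*N]] n N = begin
  n ℕ.* (n ℕ.+ n)                      ≤⟨ ℕ.m≤m+n _ _ ⟩
  n ℕ.* (n ℕ.+ n) ℕ.+ n ℕ.* (n ℕ.+ n)  ≡⟨ n*[n+n]+n*[n+n]≡4*[n*n] n ⟩
  4 ℕ.* (n ℕ.* n)                      ≤⟨ ℕ.*-monoʳ-≤ 4 (ℕ.*-monoʳ-≤ n (ℕ.m≤m*n n N)) ⟩
  4 ℕ.* (n ℕ.* (n ℕ.* N))              ∎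
  where open ℕ.≤-Reasoning

+C/1≤4*[n*[n*N/D]] : ∀ C n N D .{{_ : NonZero D}} → C ℕ.* D ℕ.≤ 4 ℕ.* (n ℕ.* (n ℕ.* N)) →
  + C / 1 ≤ (+ 4 / 1) * ((+ n / 1) * ((+ n / 1) * (+ N / D)))
+C/1≤4*[n*[n*N/D]] C n N D CD≤4nnN = begin
  + C / 1
    ≤⟨ +a/b≤+c/d C 1 (4 ℕ.* (n ℕ.* (n ℕ.* N))) D
         (ℕ.≤-trans CD≤4nnN (ℕ.≤-reflexive (sym (ℕ.*-identityʳ _)))) ⟩
  + (4 ℕ.* (n ℕ.* (n ℕ.* N))) / D
    ≡⟨ +m/1*+a/d≡+[m*a]/d 4 (n ℕ.* (n ℕ.* N)) D ⟨
  (+ 4 / 1) * (+ (n ℕ.* (n ℕ.* N)) / D)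
    ≡⟨ cong ((+ 4 / 1) *_) (+m/1*+a/d≡+[m*a]/d n (n ℕ.* N) D) ⟨
  (+ 4 / 1) * ((+ n / 1) * (+ (n ℕ.* N) / D))
    ≡⟨ cong (λ x → (+ 4 / 1) * ((+ n / 1) * x)) (+m/1*+a/d≡+[m*a]/d n N D) ⟨
  (+ 4 / 1) * ((+ n / 1) * ((+ n / 1) * (+ N / D))) ∎
  where open ℚ.≤-Reasoning

countClose-pPow-bound : ∀ p .{{_ : NonZero p}} n k →
  + countClose p n n (pPow p k) / 1 ≤ (+ 4 / 1) * ((+ n / 1) * ((+ n / 1) * pPow p k))
countClose-pPow-bound p n (+ i) =
  +C/1≤4*[n*[n*N/D]] (countClose p n n (pPow p (+ i))) n (p ^ i) 1 (ℕ.≤-trans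
    (countClose*q≤n*[n+n] p n (pPow p (+ i)) 1 (λ (a≢b , _) → a≢b , 1∣ _))
    (n*[n+n]≤4*[n*[n*N]] n (p ^ i) {{ℕ.m^n≢0 p i}}))
countClose-pPow-bound p@(suc _) zero -[1+ i ] =
  +C/1≤4*[n*[n*N/D]] 0 0 1 (p ^ suc i) {{ℕ.m^n≢0 p (suc i)}} z≤n
countClose-pPow-bound p@(suc _) n@(suc _) -[1+ i ] =
  +C/1≤4*[n*[n*N/D]] (countClose p n n (pPow p -[1+ i ])) n 1 (p ^ suc i) {{pⁱ⁺¹≢0}} (ℕ.≤-trans
    (countClose*q≤n*[n+n] p n (pPow p -[1+ i ]) (p ^ suc i) {{pⁱ⁺¹≢0}} (close⇒congruent p n i))
    (n*[n+n]≤4*[n*[n*N]] n 1))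
  where
  pⁱ⁺¹≢0 : NonZero (p ^ suc i)
  pⁱ⁺¹≢0 = ℕ.m^n≢0 p (suc i)

⊔-pres-pPow : ∀ {p x y} → ∃[ k ] x ≡ pPow p k → ∃[ k ] y ≡ pPow p k → ∃[ k ] x ⊔ y ≡ pPow p k
⊔-pres-pPow {x = x} {y} (k , x≡pᵏ) (l , y≡pˡ) with ℚ.⊔-sel x y
... | inj₁ x⊔y≡x = k , trans x⊔y≡x x≡pᵏ
... | inj₂ x⊔y≡y = l , trans x⊔y≡y y≡pˡ

mainTheorem9 : (p : ℕ) → Prime p → (ψ : ℕ → ℚ) → (∀ k → 0ℚ < ψ k) →
    (n m : ℕ) → n ≡ m → ¬ (p ∣ n) →
    (sn sm : ℚ) → IsStar p (ψ n) sn → IsStar p (ψ m) sm →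
    ((+ countClose p n m (sn ⊔ sm)) / 1) ≤ ((+ 4) / 1) * (((+ n) / 1) * (((+ m) / 1) * (sn ⊔ sm)))
mainTheorem9 p (prime _) _ _ n .n refl _ _ _ (sn-power , _) (sm-power , _)
  with k , s≡pᵏ ← ⊔-pres-pPow sn-power sm-power
  rewrite s≡pᵏ = countClose-pPow-bound p {{ℕ.nonTrivial⇒nonZero p}} n k
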